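{- Let $(Q,\ast)$ be a finite quasigroup. Let $D_1=\{x\ast x\mid x\in Q\}$ be the set of diagonal entries of its Latin square, and inductively let $D_{k+1}=\{a\ast a\mid a\in D_k\}$. Since $Q$ is finite there is a positive integer $k$ with $D_k=D_{k+1}$; put $D=D_k$. Then $Q$ has no proper subquasigroups if and only if $Q$ is generated by every element of $D$.
   Context: A quasigroup is a set $Q$ with a binary operation $\ast$ such that for all $a,b\in Q$ the equations $a\ast x=b$ and $y\ast a=b$ have unique solutions in $Q$. A subquasigroup is a subset closed under $\ast$ and the two divisions; a proper subquasigroup is a nonempty subquasigroup different from $Q$. The subquasigroup generated by an element $a$ is the smallest subquasigroup containing $a$, and $Q$ is generated by $a$ if this is $Q$. -}

module Defs where

open import Data.Nat using (ℕ; zero; suc)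
open import Data.Fin using (Fin)
open import Data.Fin.Subset using (Subset; _∈_; ⊤; Nonempty)
open import Data.Unit using () renaming (⊤ to Unit)
open import Data.Product using (Σ; ∃; _×_; _,_; proj₁)
open import Relation.Binary.PropositionalEquality using (_≡_; _≢_)

record FinQuasigroup (n : ℕ) : Set where
  infixl 7 _∗_
  field
    _∗_          : Fin n → Fin n → Fin n
    leftSolve    : ∀ a b → Σ (Fin n) λ x → a ∗ x ≡ b
    leftUnique   : ∀ a x x′ → a ∗ x ≡ a ∗ x′ → x ≡ x′
    rightSolve   : ∀ a b → Σ (Fin n) λ y → y ∗ a ≡ b
    rightUnique  : ∀ a y y′ → y ∗ a ≡ y′ ∗ a → y ≡ y′

  _\\_ : Fin n → Fin n → Fin n
  a \\ b = proj₁ (leftSolve a b)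

  _//_ : Fin n → Fin n → Fin n
  b // a = proj₁ (rightSolve a b)

module _ {n : ℕ} (Q : FinQuasigroup n) where
  open FinQuasigroup Q

  IsSubquasigroup : Subset n → Set
  IsSubquasigroup S =
    (∀ a b → a ∈ S → b ∈ S → a ∗ b ∈ S) ×
    (∀ a b → a ∈ S → b ∈ S → a \\ b ∈ S) ×
    (∀ a b → a ∈ S → b ∈ S → b // a ∈ S)

  IsProperSubquasigroup : Subset n → Set
  IsProperSubquasigroup S = IsSubquasigroup S × Nonempty S × S ≢ ⊤

  -- Q is generated by a: the smallest subquasigroup containing a
  -- (the intersection of all subquasigroups containing a) is Q,
  -- i.e. every subquasigroup containing a is all of Q.
  GeneratedBy : Fin n → Set
  GeneratedBy a = ∀ (S : Subset n) → IsSubquasigroup S → a ∈ S → ∀ x → x ∈ S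

  -- D k : D 0 = Q, D (k+1) = { a ∗ a | a ∈ D k }; so D 1 is the diagonal.
  D : ℕ → Fin n → Set
  D zero    x = Unit
  D (suc k) x = ∃ λ a → D k a × a ∗ a ≡ x

-- Any subquasigroup is closed under squaring, so a nonempty subquasigroup
-- containing a also contains the k-fold square of a, which lies in D k.
-- Hence if every element of D k generates Q, every nonempty subquasigroup
-- is Q. Conversely, without proper subquasigroups every element generates Q.
-- Neither direction uses 1 ≤ k or the stabilisation D k = D (k + 1): the
-- equivalence holds for every k.
module Submission where

open import Defs
open import Data.Bool using () renaming (_≟_ to _≟ᵇ_)
open import Data.Nat using (ℕ; zero; suc; _≤_)
open import Data.Fin using (Fin)
open import Data.Fin.Subset using (Subset; _∈_; ⊤; Nonempty)
open import Data.Fin.Subset.Properties using (∈⊤; ⊆⊤; ⊆-antisym)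
open import Data.Vec.Properties using (≡-dec)
open import Data.Product using (∃; _,_; proj₁)
open import Data.Unit using (tt)
open import Function.Bundles using (_⇔_; mk⇔)
open import Relation.Nullary using (¬_)
open import Relation.Nullary.Decidable using (decidable-stable)
open import Relation.Binary.PropositionalEquality using (_≡_; refl; sym; subst)

module _ {n : ℕ} (Q : FinQuasigroup n) where
  open FinQuasigroup Q

  NoProperSubquasigroup : Set
  NoProperSubquasigroup = ¬ ∃ λ (S : Subset n) → IsProperSubquasigroup Q S

  square^ : ℕ → Fin n → Fin n
  square^ zero    a = a
  square^ (suc j) a = square^ j a ∗ square^ j a

  square^-∈-D : ∀ j a → D Q j (square^ j a)
  square^-∈-D zero    a = tt
  square^-∈-D (suc j) a = square^ j a , square^-∈-D j a , refl

  square^-closed : ∀ {S} → IsSubquasigroup Q S → ∀ j {a} → a ∈ S → square^ j a ∈ S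
  square^-closed S-sub zero    a∈S = a∈S
  square^-closed S-sub (suc j) a∈S = proj₁ S-sub _ _ aⱼ∈S aⱼ∈S
    where aⱼ∈S = square^-closed S-sub j a∈S

  noProper⇒subquasigroup≡⊤ : NoProperSubquasigroup → ∀ {S} →
    IsSubquasigroup Q S → Nonempty S → S ≡ ⊤
  noProper⇒subquasigroup≡⊤ noProper {S} S-sub S-nonempty =
    decidable-stable (≡-dec _≟ᵇ_ S ⊤) (λ S≢⊤ → noProper (S , S-sub , S-nonempty , S≢⊤))

  noProper⇒generatedBy : NoProperSubquasigroup → ∀ a → GeneratedBy Q a
  noProper⇒generatedBy noProper a S S-sub a∈S x =
    subst (x ∈_) (sym (noProper⇒subquasigroup≡⊤ noProper S-sub (a , a∈S))) ∈⊤

  generatedBy⇒subquasigroup≡⊤ : ∀ {a S} → GeneratedBy Q a →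
    IsSubquasigroup Q S → a ∈ S → S ≡ ⊤
  generatedBy⇒subquasigroup≡⊤ gen S-sub a∈S =
    ⊆-antisym ⊆⊤ (λ {x} _ → gen _ S-sub a∈S x)

  generatedBy-D⇒noProper : ∀ k → (∀ d → D Q k d → GeneratedBy Q d) →
    NoProperSubquasigroup
  generatedBy-D⇒noProper k gen (S , S-sub , (a , a∈S) , S≢⊤) =
    S≢⊤ (generatedBy⇒subquasigroup≡⊤ (gen _ (square^-∈-D k a)) S-sub
                                      (square^-closed S-sub k a∈S))

proposition4 : ∀ {n : ℕ} (Q : FinQuasigroup n) (k : ℕ) → 1 ≤ k →
    (∀ x → D Q k x ⇔ D Q (suc k) x) →
    ((¬ ∃ λ (S : Subset n) → IsProperSubquasigroup Q S) ⇔
     (∀ d → D Q k d → GeneratedBy Q d))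
proposition4 Q k _ _ =
  mk⇔ (λ noProper d _ → noProper⇒generatedBy Q noProper d)
      (generatedBy-D⇒noProper Q k)
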